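{- $\mathrm{HNN}\subseteq\mathrm{THR}\circ\mathrm{MAJ}$. Namely, every function $f:\{0,1\}^n\to\{0,1\}$ with an HNN representation with $m$ anchors is computed by a threshold gate applied to $2nm$ majority gates.
   Context: Let $\Delta(\mathbf{x},\mathbf{y})=\|\mathbf{x}-\mathbf{y}\|_2^2$. An HNN representation of $f$ is a pair of disjoint sets $P,N\subseteq\{0,1\}^n$ (anchors, $m=|P|+|N|$) such that $f(\mathbf{x})=1$ if some $\mathbf{p}\in P$ has $\Delta(\mathbf{x},\mathbf{p})<\Delta(\mathbf{x},\mathbf{q})$ for all $\mathbf{q}\in N$, and $f(\mathbf{x})=0$ if some $\mathbf{q}\in N$ has $\Delta(\mathbf{x},\mathbf{q})<\Delta(\mathbf{x},\mathbf{p})$ for all $\mathbf{p}\in P$. $\mathrm{HNN}$ is the class of (families of) functions with HNN representations with polynomially many anchors. A threshold gate is $\mathbf{1}[\langle\mathbf{w},\mathbf{z}\rangle\ge\theta]$ with arbitrary (integer) weights; a majority gate is a threshold gate with integer weights and threshold polynomially bounded in absolute value. $\mathrm{THR}\circ\mathrm{MAJ}$ is the class of functions computed by a threshold gate whose inputs are outputs of polynomially many majority gates, each taking as inputs variables, negated variables, or constants. -}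

module Defs where

open import Data.Bool using (Bool; true; false; if_then_else_)
open import Data.Nat as ℕ using (ℕ)
open import Data.Integer as ℤ using (ℤ; +_; _≤ᵇ_)
open import Data.Fin using (Fin; zero; suc)
open import Data.Vec using (Vec; lookup)
open import Data.List using (List; length)
open import Data.List.Membership.Propositional using (_∈_)
open import Data.List.Relation.Unary.Any using (Any)
open import Data.List.Relation.Unary.All using (All)
open import Data.List.Relation.Unary.Unique.Propositional using (Unique)
open import Data.Product using (_×_)
open import Data.Sum using (_⊎_)
open import Relation.Binary.PropositionalEquality using (_≡_)
open import Relation.Nullary using (¬_)

Point : ℕ → Set
Point n = Vec Bool n

b2z : Bool → ℤ
b2z true  = + 1
b2z false = + 0

sumℤ : (n : ℕ) → (Fin n → ℤ) → ℤ
sumℤ ℕ.zero    g = + 0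
sumℤ (ℕ.suc n) g = g zero ℤ.+ sumℤ n (λ i → g (suc i))

Δ : {n : ℕ} → Point n → Point n → ℤ
Δ {n} x y = sumℤ n (λ i → (b2z (lookup x i) ℤ.- b2z (lookup y i))
                          ℤ.* (b2z (lookup x i) ℤ.- b2z (lookup y i)))

CloserTo : {n : ℕ} → List (Point n) → List (Point n) → Point n → Set
CloserTo A B x = Any (λ a → All (λ b → Δ x a ℤ.< Δ x b) B) A

record HNNRep {n : ℕ} (f : Point n → Bool) (P N : List (Point n)) : Set where
  field
    uniqueP  : Unique P
    uniqueN  : Unique N
    disjoint : ∀ {a} → a ∈ P → ¬ (a ∈ N)
    pos      : ∀ x → CloserTo P N x → f x ≡ true
    neg      : ∀ x → CloserTo N P x → f x ≡ false
    -- the representation determines f everywhere (no ties)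
    decides  : ∀ x → CloserTo P N x ⊎ CloserTo N P x

anchors : {n : ℕ} → List (Point n) → List (Point n) → ℕ
anchors P N = length P ℕ.+ length N

thr : (k : ℕ) → (Fin k → ℤ) → ℤ → (Fin k → Bool) → Bool
thr k w θ z = θ ≤ᵇ sumℤ k (λ j → w j ℤ.* b2z (z j))

-- a gate over the literals x_i, ¬x_i (i < n) and constants:
-- weight wpos i on x_i, wneg i on ¬x_i, constant inputs folded into θ
record LitGate (n : ℕ) : Set where
  field
    wpos : Fin n → ℤ
    wneg : Fin n → ℤ
    θ    : ℤ

neg : Bool → Bool
neg b = if b then false else true

evalLit : {n : ℕ} → LitGate n → Point n → Bool
evalLit {n} g x = θ ≤ᵇ sumℤ n (λ i → wpos i ℤ.* b2z (lookup x i)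
                                    ℤ.+ wneg i ℤ.* b2z (neg (lookup x i)))
  where open LitGate g

Bounded : {n : ℕ} → ℕ → LitGate n → Set
Bounded B g = (∀ i → ℤ.∣ wpos i ∣ ℕ.≤ B) × (∀ i → ℤ.∣ wneg i ∣ ℕ.≤ B) × (ℤ.∣ θ ∣ ℕ.≤ B)
  where open LitGate g

module Submission where

-- Let e_k(x) be the number of positive minus the number of negative anchors within distance k
-- of x. Each term [Δ(x,a) ≤ k] is a majority gate, because -Δ(x,a) is a sum of ±1-weighted
-- literals. If x is strictly closer to a positive anchor at distance d than to every negative
-- anchor, then e_k(x) ≥ 0 for k < d, e_d(x) ≥ 1 and e_k(x) ≥ -m throughout, so the radix-(m+1)
-- numeral with digits e_0(x), …, e_n(x) is positive; when a negative anchor wins it is negative.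
-- Reading that numeral with a single threshold gate computes f.

open import Defs
open import Data.Bool using (Bool; true; false; T; if_then_else_)
open import Data.Bool.Properties using (T-≡)
open import Data.Nat as ℕ using (ℕ; zero; suc)
import Data.Nat.Properties as ℕₚ
open import Data.Integer using (ℤ)
open import Data.Fin using (Fin; zero; suc)
open import Data.Vec using (lookup)
open import Data.List using (List; []; _∷_; _++_; map; length)
open import Data.List.Properties using (length-++; length-map)
open import Data.List.Membership.Propositional using (find; lose)
open import Data.List.Relation.Unary.All as All using (All; []; _∷_)
open import Data.List.Relation.Unary.All.Properties using (++⁺; map⁺)
open import Data.List.Relation.Unary.Any using (Any; here; there)
open import Data.Product using (Σ; _×_; _,_; proj₁; proj₂; map₂)
open import Data.Sum using (inj₁; inj₂)
open import Function using (_∘_; Equivalence)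
open import Relation.Binary.PropositionalEquality
  using (_≡_; refl; sym; trans; cong; cong₂; subst; module ≡-Reasoning)
open import Relation.Nullary using (contradiction)

-- Integer arithmetic is opened only in this block, so that _*_ in the statement below is
-- multiplication on ℕ.
module _ where
  open import Data.Integer
    using (+_; 0ℤ; 1ℤ; -1ℤ; _+_; _-_; -_; _*_; _≤_; _<_; _≤ᵇ_; ∣_∣; +≤+; -<+)
  open import Data.Integer.Properties
  open import Data.Integer.Tactic.RingSolver using (solve-∀)

  ≤ᵇ-true : ∀ {i j} → i ≤ j → (i ≤ᵇ j) ≡ true
  ≤ᵇ-true = Equivalence.to T-≡ ∘ ≤⇒≤ᵇ

  ≤ᵇ-false : ∀ {i j} → j < i → (i ≤ᵇ j) ≡ false
  ≤ᵇ-false {i} {j} j<i with i ≤ᵇ j in eq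
  ... | true  = contradiction (≤ᵇ⇒≤ (subst T (sym eq) _)) (<⇒≱ j<i)
  ... | false = refl

  sumℤ-cong : ∀ n {g h : Fin n → ℤ} → (∀ i → g i ≡ h i) → sumℤ n g ≡ sumℤ n h
  sumℤ-cong zero    g≡h = refl
  sumℤ-cong (suc n) g≡h = cong₂ _+_ (g≡h zero) (sumℤ-cong n (g≡h ∘ suc))

  sumℤ-zero : ∀ n {g : Fin n → ℤ} → (∀ i → g i ≡ 0ℤ) → sumℤ n g ≡ 0ℤ
  sumℤ-zero zero    g≡0 = refl
  sumℤ-zero (suc n) g≡0 = cong₂ _+_ (g≡0 zero) (sumℤ-zero n (g≡0 ∘ suc))

  sumℤ-neg : ∀ n (g : Fin n → ℤ) → sumℤ n (-_ ∘ g) ≡ - sumℤ n g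
  sumℤ-neg zero    g = refl
  sumℤ-neg (suc n) g = trans (cong (_+_ (- g zero)) (sumℤ-neg n (g ∘ suc)))
                             (sym (neg-distrib-+ (g zero) (sumℤ n (g ∘ suc))))

  sumℤ-nonneg : ∀ n {g : Fin n → ℤ} → (∀ i → 0ℤ ≤ g i) → 0ℤ ≤ sumℤ n g
  sumℤ-nonneg zero    0≤g = ≤-refl
  sumℤ-nonneg (suc n) 0≤g = +-mono-≤ (0≤g zero) (sumℤ-nonneg n (0≤g ∘ suc))

  sumℤ-≤-length : ∀ n {g : Fin n → ℤ} → (∀ i → g i ≤ 1ℤ) → sumℤ n g ≤ + n
  sumℤ-≤-length zero    g≤1 = ≤-refl
  sumℤ-≤-length (suc n) g≤1 = +-mono-≤ (g≤1 zero) (sumℤ-≤-length n (g≤1 ∘ suc))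

  b2z-nonneg : ∀ b → 0ℤ ≤ b2z b
  b2z-nonneg true  = +≤+ ℕ.z≤n
  b2z-nonneg false = +≤+ ℕ.z≤n

  b2z-≤-1 : ∀ b → b2z b ≤ 1ℤ
  b2z-≤-1 true  = ≤-refl
  b2z-≤-1 false = +≤+ ℕ.z≤n

  Δ-nonneg : ∀ {n} (x y : Point n) → 0ℤ ≤ Δ x y
  Δ-nonneg {n} x y = sumℤ-nonneg n (λ i → square-nonneg (lookup x i) (lookup y i))
    where
    square-nonneg : ∀ u v → 0ℤ ≤ (b2z u - b2z v) * (b2z u - b2z v)
    square-nonneg true  true  = ≤-refl
    square-nonneg true  false = +≤+ ℕ.z≤n
    square-nonneg false true  = +≤+ ℕ.z≤n
    square-nonneg false false = ≤-refl

  Δ-≤-dim : ∀ {n} (x y : Point n) → Δ x y ≤ + n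
  Δ-≤-dim {n} x y = sumℤ-≤-length n (λ i → square-≤-1 (lookup x i) (lookup y i))
    where
    square-≤-1 : ∀ u v → (b2z u - b2z v) * (b2z u - b2z v) ≤ 1ℤ
    square-≤-1 true  true  = +≤+ ℕ.z≤n
    square-≤-1 true  false = ≤-refl
    square-≤-1 false true  = ≤-refl
    square-≤-1 false false = +≤+ ℕ.z≤n

  -- The literal of x_i that disagrees with a_i has weight -1, so the weighted sum is -Δ(x,a).
  ball : ∀ {n} → Point n → ℕ → LitGate n
  ball a k = record
    { wpos = λ i → if lookup a i then 0ℤ else -1ℤ
    ; wneg = λ i → if lookup a i then -1ℤ else 0ℤ
    ; θ    = - + k
    }

  evalLit-ball : ∀ {n} (a x : Point n) k → evalLit (ball a k) x ≡ (- + k ≤ᵇ - Δ x a)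
  evalLit-ball {n} a x k = cong (- + k ≤ᵇ_)
    (trans (sumℤ-cong n (λ i → disagreement (lookup x i) (lookup a i))) (sumℤ-neg n _))
    where
    disagreement : ∀ u v →
      (if v then 0ℤ else -1ℤ) * b2z u + (if v then -1ℤ else 0ℤ) * b2z (neg u)
        ≡ - ((b2z u - b2z v) * (b2z u - b2z v))
    disagreement true  true  = refl
    disagreement true  false = refl
    disagreement false true  = refl
    disagreement false false = refl

  ball-inside : ∀ {n} (a x : Point n) {k} → Δ x a ≤ + k → evalLit (ball a k) x ≡ true
  ball-inside a x {k} Δ≤k = trans (evalLit-ball a x k) (≤ᵇ-true (neg-mono-≤ Δ≤k))

  ball-outside : ∀ {n} (a x : Point n) {k} → + k < Δ x a → evalLit (ball a k) x ≡ false
  ball-outside a x {k} k<Δ = trans (evalLit-ball a x k) (≤ᵇ-false (neg-mono-< k<Δ))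

  Bounded-mono : ∀ {n B C} {g : LitGate n} → B ℕ.≤ C → Bounded B g → Bounded C g
  Bounded-mono B≤C (wpos≤B , wneg≤B , θ≤B) =
    (λ i → ℕₚ.≤-trans (wpos≤B i) B≤C) ,
    (λ i → ℕₚ.≤-trans (wneg≤B i) B≤C) ,
    ℕₚ.≤-trans θ≤B B≤C

  ball-bounded : ∀ {n} (a : Point n) {k} → k ℕ.≤ n → Bounded (suc n) (ball a k)
  ball-bounded {n} a {k} k≤n =
    (λ i → ∣if∣≤ (lookup a i) ℕ.z≤n one≤) ,
    (λ i → ∣if∣≤ (lookup a i) one≤ ℕ.z≤n) ,
    subst (ℕ._≤ _) (sym (∣-i∣≡∣i∣ (+ k))) (ℕₚ.m≤n⇒m≤1+n k≤n)
    where
    one≤ : 1 ℕ.≤ suc n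
    one≤ = ℕ.s≤s ℕ.z≤n
    ∣if∣≤ : ∀ b {i j B} → ∣ i ∣ ℕ.≤ B → ∣ j ∣ ℕ.≤ B → ∣ if b then i else j ∣ ℕ.≤ B
    ∣if∣≤ true  i≤B j≤B = i≤B
    ∣if∣≤ false i≤B j≤B = j≤B

  near : ∀ {n} → Point n → ℕ → List (Point n) → ℤ
  near x k []      = 0ℤ
  near x k (a ∷ A) = b2z (evalLit (ball a k) x) + near x k A

  module _ {n} (x : Point n) {k : ℕ} where

    near-nonneg : ∀ A → 0ℤ ≤ near x k A
    near-nonneg []      = ≤-refl
    near-nonneg (a ∷ A) = +-mono-≤ (b2z-nonneg (evalLit (ball a k) x)) (near-nonneg A)

    near-≤-length : ∀ A → near x k A ≤ + length A
    near-≤-length []      = ≤-refl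
    near-≤-length (a ∷ A) = +-mono-≤ (b2z-≤-1 (evalLit (ball a k) x)) (near-≤-length A)

    near-none : ∀ {B} → All (λ b → + k < Δ x b) B → near x k B ≡ 0ℤ
    near-none []                      = refl
    near-none {b ∷ _} (k<Δ ∷ outside)
      rewrite ball-outside b x k<Δ | near-none outside = refl

    near-all : ∀ {A} → All (λ a → Δ x a ≤ + k) A → near x k A ≡ + length A
    near-all []                     = refl
    near-all {a ∷ _} (Δ≤k ∷ inside)
      rewrite ball-inside a x Δ≤k | near-all inside = refl

    near-pos : ∀ {A} → Any (λ a → Δ x a ≤ + k) A → 1ℤ ≤ near x k A
    near-pos {a ∷ A} (here Δ≤k)
      rewrite ball-inside a x Δ≤k = +-mono-≤ (≤-refl {1ℤ}) (near-nonneg A)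
    near-pos {a ∷ A} (there some) = +-mono-≤ (b2z-nonneg (evalLit (ball a k) x)) (near-pos some)

  digit : ∀ {n} → Point n → List (Point n) → List (Point n) → ℕ → ℤ
  digit x A B k = near x k A - near x k B

  horner : ℕ → (ℕ → ℤ) → ℕ → ℤ
  horner r e zero    = 0ℤ
  horner r e (suc k) = + r * horner r e k + e k

  horner-cong : ∀ r {e e′} → (∀ j → e j ≡ e′ j) → ∀ k → horner r e k ≡ horner r e′ k
  horner-cong r e≡e′ zero    = refl
  horner-cong r e≡e′ (suc k) = cong₂ (λ h d → + r * h + d) (horner-cong r e≡e′ k) (e≡e′ k)

  horner-neg : ∀ r e k → horner r (-_ ∘ e) k ≡ - horner r e k
  horner-neg r e zero    = refl
  horner-neg r e (suc k) = begin
    + r * horner r (-_ ∘ e) k - e k ≡⟨ cong (λ h → + r * h - e k) (horner-neg r e k) ⟩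
    + r * - horner r e k - e k      ≡⟨ neg-out (+ r) (horner r e k) (e k) ⟩
    - (+ r * horner r e k + e k)    ∎
    where
    open ≡-Reasoning
    neg-out : ∀ a h c → a * - h - c ≡ - (a * h + c)
    neg-out = solve-∀

  0≤i⇒0≤+n*i : ∀ r {i} → 0ℤ ≤ i → 0ℤ ≤ + r * i
  0≤i⇒0≤+n*i r {i} 0≤i = subst (_≤ + r * i) (*-zeroʳ (+ r)) (*-monoˡ-≤-nonNeg (+ r) 0≤i)

  horner-nonneg : ∀ r e k → (∀ j → j ℕ.< k → 0ℤ ≤ e j) → 0ℤ ≤ horner r e k
  horner-nonneg r e zero    digits = ≤-refl
  horner-nonneg r e (suc k) digits =
    +-mono-≤ (0≤i⇒0≤+n*i r (horner-nonneg r e k (λ j → digits j ∘ ℕₚ.m<n⇒m<1+n)))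
             (digits k (ℕₚ.n<1+n k))

  -- Once the numeral is at least 1, the shift by m+1 gains more than a digit ≥ -m can lose.
  horner-pos : ∀ m e d →
               (∀ j → j ℕ.< d → 0ℤ ≤ e j) → 1ℤ ≤ e d → (∀ j → - + m ≤ e j) →
               ∀ k → d ℕ.< k → 1ℤ ≤ horner (suc m) e k
  horner-pos m e d below leading digits (suc k) (ℕ.s≤s d≤k) with ℕₚ.m≤n⇒m<n∨m≡n d≤k
  ... | inj₁ d<k = carry (horner-pos m e d below leading digits k d<k) (digits k)
    where
    open ≤-Reasoning
    carry : ∀ {h c} → 1ℤ ≤ h → - + m ≤ c → 1ℤ ≤ + suc m * h + c
    carry {h} {c} 1≤h -m≤c = begin
      1ℤ                     ≡⟨ cancel (+ m) ⟩
      + suc m * 1ℤ + - + m   ≤⟨ +-mono-≤ (*-monoˡ-≤-nonNeg (+ suc m) 1≤h) -m≤c ⟩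
      + suc m * h + c        ∎
      where
      -- stated with 1ℤ + t, which is how + suc m computes
      cancel : ∀ t → 1ℤ ≡ (1ℤ + t) * 1ℤ + - t
      cancel = solve-∀
  ... | inj₂ refl = +-mono-≤ (0≤i⇒0≤+n*i (suc m) (horner-nonneg (suc m) e k below)) leading

  WeightedGate : ℕ → Set
  WeightedGate n = LitGate n × ℤ

  output : ∀ {n} → Point n → WeightedGate n → ℤ
  output x (g , w) = w * b2z (evalLit g x)

  weightedSum : ∀ {n} → Point n → List (WeightedGate n) → ℤ
  weightedSum x []       = 0ℤ
  weightedSum x (g ∷ gs) = output x g + weightedSum x gs

  module _ {n} (x : Point n) where

    weightedSum-++ : ∀ gs hs → weightedSum x (gs ++ hs) ≡ weightedSum x gs + weightedSum x hs
    weightedSum-++ []       hs = sym (+-identityˡ _)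
    weightedSum-++ (g ∷ gs) hs =
      trans (cong (_+_ (output x g)) (weightedSum-++ gs hs)) (sym (+-assoc (output x g) _ _))

    weightedSum-scale : ∀ c gs → weightedSum x (map (map₂ (c *_)) gs) ≡ c * weightedSum x gs
    weightedSum-scale c []             = sym (*-zeroʳ c)
    weightedSum-scale c ((g , w) ∷ gs) =
      trans (cong₂ _+_ (*-assoc c w _) (weightedSum-scale c gs)) (sym (*-distribˡ-+ c _ _))

    weightedSum-balls : ∀ w k A → weightedSum x (map (λ a → ball a k , w) A) ≡ w * near x k A
    weightedSum-balls w k []      = sym (*-zeroʳ w)
    weightedSum-balls w k (a ∷ A) =
      trans (cong (_+_ (output x (ball a k , w))) (weightedSum-balls w k A))
            (sym (*-distribˡ-+ w _ _))

  layer : ∀ {n} → List (Point n) → List (Point n) → ℕ → List (WeightedGate n)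
  layer A B k = map (λ a → ball a k , 1ℤ) A ++ map (λ b → ball b k , -1ℤ) B

  levels : ∀ {n} → ℕ → List (Point n) → List (Point n) → ℕ → List (WeightedGate n)
  levels r A B zero    = []
  levels r A B (suc k) = map (map₂ (+ r *_)) (levels r A B k) ++ layer A B k

  module _ {n} (x : Point n) (A B : List (Point n)) where

    weightedSum-layer : ∀ k → weightedSum x (layer A B k) ≡ digit x A B k
    weightedSum-layer k = begin
      weightedSum x (layer A B k)
        ≡⟨ weightedSum-++ x (map (λ a → ball a k , 1ℤ) A) _ ⟩
      weightedSum x (map (λ a → ball a k , 1ℤ) A)
        + weightedSum x (map (λ b → ball b k , -1ℤ) B)
        ≡⟨ cong₂ _+_ (weightedSum-balls x 1ℤ k A) (weightedSum-balls x -1ℤ k B) ⟩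
      1ℤ * near x k A + -1ℤ * near x k B
        ≡⟨ cong₂ _+_ (*-identityˡ (near x k A)) (-1*i≡-i (near x k B)) ⟩
      digit x A B k ∎
      where open ≡-Reasoning

    weightedSum-levels : ∀ r k → weightedSum x (levels r A B k) ≡ horner r (digit x A B) k
    weightedSum-levels r zero    = refl
    weightedSum-levels r (suc k) = begin
      weightedSum x (map (map₂ (+ r *_)) (levels r A B k) ++ layer A B k)
        ≡⟨ weightedSum-++ x (map (map₂ (+ r *_)) (levels r A B k)) _ ⟩
      weightedSum x (map (map₂ (+ r *_)) (levels r A B k)) + weightedSum x (layer A B k)
        ≡⟨ cong₂ _+_ (weightedSum-scale x (+ r) (levels r A B k)) (weightedSum-layer k) ⟩
      + r * weightedSum x (levels r A B k) + digit x A B k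
        ≡⟨ cong (λ h → + r * h + digit x A B k) (weightedSum-levels r k) ⟩
      horner r (digit x A B) (suc k) ∎
      where open ≡-Reasoning

  module _ {n} (A B : List (Point n)) where

    length-levels : ∀ r k → length (levels r A B k) ≡ k ℕ.* (length A ℕ.+ length B)
    length-levels r zero    = refl
    length-levels r (suc k) = begin
      length (map (map₂ (+ r *_)) (levels r A B k) ++ layer A B k)
        ≡⟨ length-++ (map (map₂ (+ r *_)) (levels r A B k)) ⟩
      length (map (map₂ (+ r *_)) (levels r A B k)) ℕ.+ length (layer A B k)
        ≡⟨ cong₂ ℕ._+_ (trans (length-map _ (levels r A B k)) (length-levels r k))
                       length-layer ⟩
      k ℕ.* (length A ℕ.+ length B) ℕ.+ (length A ℕ.+ length B)
        ≡⟨ ℕₚ.+-comm (k ℕ.* _) _ ⟩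
      suc k ℕ.* (length A ℕ.+ length B) ∎
      where
      open ≡-Reasoning
      length-layer : length (layer A B k) ≡ length A ℕ.+ length B
      length-layer = trans (length-++ (map (λ a → ball a k , 1ℤ) A))
                           (cong₂ ℕ._+_ (length-map _ A) (length-map _ B))

    levels-bounded : ∀ r k → k ℕ.≤ n → All (Bounded (suc n) ∘ proj₁) (levels r A B k)
    levels-bounded r zero    k≤n = []
    levels-bounded r (suc k) k<n = ++⁺ (map⁺ (levels-bounded r k (ℕₚ.<⇒≤ k<n)))
      (++⁺ (map⁺ (All.universal (λ a → ball-bounded a (ℕₚ.<⇒≤ k<n)) A))
           (map⁺ (All.universal (λ b → ball-bounded b (ℕₚ.<⇒≤ k<n)) B)))

  horner-swap : ∀ {n} (x : Point n) A B r k → horner r (digit x B A) k ≡ - horner r (digit x A B) k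
  horner-swap x A B r k = trans (horner-cong r (λ j → swap (near x j A) (near x j B)) k)
                                (horner-neg r (digit x A B) k)
    where
    swap : ∀ a b → b - a ≡ - (a - b)
    swap = solve-∀

  closer⇒horner-pos : ∀ {n} (x : Point n) {m A B} → length B ℕ.≤ m → CloserTo A B x →
                      1ℤ ≤ horner (suc m) (digit x A B) (suc n)
  closer⇒horner-pos {n} x {m} {A} {B} |B|≤m closer with find closer
  ... | a , a∈A , a-wins = horner-pos m (digit x A B) d below leading bounded (suc n) (ℕ.s≤s d≤n)
    where
    d : ℕ
    d = ∣ Δ x a ∣
    d≡Δ : + d ≡ Δ x a
    d≡Δ = 0≤i⇒+∣i∣≡i (Δ-nonneg x a)
    d≤n : d ℕ.≤ n
    d≤n = drop‿+≤+ (subst (_≤ + n) (sym d≡Δ) (Δ-≤-dim x a))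
    digit≡near : ∀ {k} → k ℕ.≤ d → digit x A B k ≡ near x k A
    digit≡near {k} k≤d =
      trans (cong (_-_ (near x k A)) (near-none x (All.map (≤-<-trans k≤Δ) a-wins)))
            (+-identityʳ _)
      where
      k≤Δ : + k ≤ Δ x a
      k≤Δ = subst (+ k ≤_) d≡Δ (+≤+ k≤d)
    below : ∀ j → j ℕ.< d → 0ℤ ≤ digit x A B j
    below j j<d = subst (0ℤ ≤_) (sym (digit≡near (ℕₚ.<⇒≤ j<d))) (near-nonneg x A)
    leading : 1ℤ ≤ digit x A B d
    leading = subst (1ℤ ≤_) (sym (digit≡near ℕₚ.≤-refl))
                    (near-pos x (lose a∈A (subst (_≤ + d) d≡Δ ≤-refl)))
    bounded : ∀ j → - + m ≤ digit x A B j
    bounded j = subst (_≤ digit x A B j) (+-identityˡ _)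
      (+-mono-≤ (near-nonneg x A) (neg-mono-≤ (≤-trans (near-≤-length x B) (+≤+ |B|≤m))))

  -- The digit at the top level n is the constant |P| - |N|, since every point lies within
  -- distance n of every anchor; it is moved into the threshold, leaving n·m gates.
  network : ∀ {n} → List (Point n) → List (Point n) → List (WeightedGate n)
  network {n} P N = map (map₂ (+ suc (anchors P N) *_)) (levels (suc (anchors P N)) P N n)

  topDigit : ∀ {n} → List (Point n) → List (Point n) → ℤ
  topDigit P N = + length P - + length N

  networkThreshold : ∀ {n} → List (Point n) → List (Point n) → ℤ
  networkThreshold P N = 1ℤ - topDigit P N

  module _ {n} (P N : List (Point n)) where

    length-network : length (network P N) ℕ.≤ 2 ℕ.* n ℕ.* anchors P N
    length-network = subst (ℕ._≤ 2 ℕ.* n ℕ.* anchors P N)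
      (sym (trans (length-map _ (levels r P N n)) (length-levels P N r n)))
      (ℕₚ.*-monoˡ-≤ (anchors P N) (ℕₚ.m≤m+n n (n ℕ.+ 0)))
      where
      r : ℕ
      r = suc (anchors P N)

    network-bounded : All (Bounded (suc n) ∘ proj₁) (network P N)
    network-bounded = map⁺ (levels-bounded P N _ n ℕₚ.≤-refl)

    module _ (x : Point n) where

      numeral : ℤ
      numeral = horner (suc (anchors P N)) (digit x P N) (suc n)

      weightedSum-network : weightedSum x (network P N) ≡ numeral - topDigit P N
      weightedSum-network = begin
        weightedSum x (network P N)        ≡⟨ weightedSum-scale x M (levels _ P N n) ⟩
        M * weightedSum x (levels _ P N n) ≡⟨ cong (M *_) (weightedSum-levels x P N _ n) ⟩
        M * H                              ≡⟨ add-sub M H E ⟩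
        (M * H + E) - E                    ≡⟨ cong (λ e → (M * H + e) - E) (sym top-digit) ⟩
        numeral - E                        ∎
        where
        open ≡-Reasoning
        M H E : ℤ
        M = + suc (anchors P N)
        H = horner (suc (anchors P N)) (digit x P N) n
        E = topDigit P N
        add-sub : ∀ a h e → a * h ≡ (a * h + e) - e
        add-sub = solve-∀
        top-digit : digit x P N n ≡ E
        top-digit = cong₂ _-_ (near-all x (All.universal (Δ-≤-dim x) P))
                              (near-all x (All.universal (Δ-≤-dim x) N))

      network-accepts : CloserTo P N x → networkThreshold P N ≤ weightedSum x (network P N)
      network-accepts closer = begin
        1ℤ - topDigit P N           ≤⟨ +-monoˡ-≤ (- topDigit P N) 1≤numeral ⟩
        numeral - topDigit P N      ≡⟨ sym weightedSum-network ⟩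
        weightedSum x (network P N) ∎
        where
        open ≤-Reasoning
        1≤numeral : 1ℤ ≤ numeral
        1≤numeral = closer⇒horner-pos x (ℕₚ.m≤n+m (length N) (length P)) closer

      network-rejects : CloserTo N P x → weightedSum x (network P N) < networkThreshold P N
      network-rejects closer = begin-strict
        weightedSum x (network P N) ≡⟨ weightedSum-network ⟩
        numeral - topDigit P N      <⟨ +-monoˡ-< (- topDigit P N) numeral<1 ⟩
        1ℤ - topDigit P N           ∎
        where
        open ≤-Reasoning
        1≤-numeral : 1ℤ ≤ - numeral
        1≤-numeral = subst (1ℤ ≤_) (horner-swap x P N (suc (anchors P N)) (suc n))
                         (closer⇒horner-pos x (ℕₚ.m≤m+n (length P) (length N)) closer)
        numeral<1 : numeral < 1ℤ
        numeral<1 = ≤-<-trans (subst (_≤ -1ℤ) (neg-involutive numeral) (neg-mono-≤ 1≤-numeral))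
                              -<+

  network-decides : ∀ {n} {f : Point n → Bool} {P N} → HNNRep f P N →
                    ∀ x → f x ≡ (networkThreshold P N ≤ᵇ weightedSum x (network P N))
  network-decides {P = P} {N} rep x with HNNRep.decides rep x
  ... | inj₁ closer =
    trans (HNNRep.pos rep x closer) (sym (≤ᵇ-true (network-accepts P N x closer)))
  ... | inj₂ closer =
    trans (HNNRep.neg rep x closer) (sym (≤ᵇ-false (network-rejects P N x closer)))

  padTo : ∀ {X : Set} → List X → X → (K : ℕ) → Fin K → X
  padTo []      d K       j       = d
  padTo (a ∷ L) d zero    ()
  padTo (a ∷ L) d (suc K) zero    = a
  padTo (a ∷ L) d (suc K) (suc j) = padTo L d K j

  padTo-All : ∀ {X : Set} {Q : X → Set} {L d} K → All Q L → Q d → ∀ j → Q (padTo L d K j)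
  padTo-All K       []        Qd j       = Qd
  padTo-All (suc K) (Qa ∷ QL) Qd zero    = Qa
  padTo-All (suc K) (Qa ∷ QL) Qd (suc j) = padTo-All K QL Qd j

  idle : ∀ {n} → WeightedGate n
  idle = record { wpos = λ _ → 0ℤ ; wneg = λ _ → 0ℤ ; θ = 0ℤ } , 0ℤ

  idle-bounded : ∀ {n B} → Bounded B (proj₁ (idle {n}))
  idle-bounded = (λ _ → ℕ.z≤n) , (λ _ → ℕ.z≤n) , ℕ.z≤n

  thr-padTo : ∀ {n} (x : Point n) {K} θ gs → length gs ℕ.≤ K →
              thr K (proj₂ ∘ padTo gs idle K) θ (λ j → evalLit (proj₁ (padTo gs idle K j)) x)
              ≡ (θ ≤ᵇ weightedSum x gs)
  thr-padTo x θ gs |gs|≤K = cong (θ ≤ᵇ_) (sum-padTo gs |gs|≤K)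
    where
    sum-padTo : ∀ {K} gs → length gs ℕ.≤ K →
                sumℤ K (output x ∘ padTo gs idle K) ≡ weightedSum x gs
    sum-padTo {K}     []       _              = sumℤ-zero K (λ _ → refl)
    sum-padTo {suc K} (g ∷ gs) (ℕ.s≤s |gs|≤K) = cong (_+_ (output x g)) (sum-padTo gs |gs|≤K)

open import Data.Nat using (_*_; _^_)

theorem15 : Σ ℕ λ c → (n : ℕ) (f : Point n → Bool) (P N : List (Point n)) → HNNRep f P N →
    Σ (Fin (2 * n * anchors P N) → LitGate n) λ gates →
    ((j : Fin (2 * n * anchors P N)) → Bounded (suc n ^ c) (gates j)) ×
    Σ (Fin (2 * n * anchors P N) → ℤ) λ w → Σ ℤ λ θ →
    ((x : Point n) → f x ≡ thr (2 * n * anchors P N) w θ (λ j → evalLit (gates j) x))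
theorem15 = 1 , λ n f P N rep →
  let K : ℕ
      K = 2 * n * anchors P N
      gates : Fin K → WeightedGate n
      gates = padTo (network P N) idle K
  in proj₁ ∘ gates ,
     (λ j → Bounded-mono {g = proj₁ (gates j)}
              (ℕₚ.≤-reflexive (sym (ℕₚ.^-identityʳ (suc n))))
              (padTo-All K (network-bounded P N) idle-bounded j)) ,
     proj₂ ∘ gates , networkThreshold P N ,
     λ x → trans (network-decides rep x)
                 (sym (thr-padTo x (networkThreshold P N) (network P N) (length-network P N)))
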